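{- Let $S$ be a finite nonempty semigroup all of whose nontrivial subgroups have prime order. Then the simplicial complexes ${\cal H}_0(S)$ and ${\cal H}(\mathrm{Sub}(S),\mu_{\mathrm{Sub}(S)})$ are isomorphic. Moreover, if $S$ is aperiodic, then $s^+\ne t^+$ for all distinct $s,t\in S$, so that ${\cal H}(S)={\cal H}_0(S)$ under the identification $s\mapsto s^+$.
   Context: For a finite nonempty semigroup $S$ and $Y\subseteq S$, $Y^+$ denotes the subsemigroup generated by $Y$ ($\emptyset^+=\emptyset$), and $s^+=\{s\}^+$ (a cyclic subsemigroup). $S$ is aperiodic if all its subgroups are trivial. $\mathrm{Sub}(S)$ is the lattice of all subsemigroups of $S$ (including $\emptyset$) ordered by inclusion. The subsemigroup complex ${\cal H}(S)$ has vertex set $S$, and $X\subseteq S$ is a face iff it admits an enumeration $x_1,\dots,x_k$ with $\emptyset\subset\{x_1\}^+\subset\cdots\subset\{x_1,\dots,x_k\}^+$ (all inclusions strict). ${\cal H}_0(S)$ is the simplicial complex whose vertex set is the set of cyclic subsemigroups of $S$, a set $\{C_1,\dots,C_k\}$ of distinct cyclic subsemigroups being a face iff it admits an enumeration with $C_1\subset(C_1\cup C_2)^+\subset\cdots\subset(C_1\cup\cdots\cup C_k)^+$ (all inclusions strict). An element $a$ of a finite lattice $L$ is strictly join irreducible (sji) if it covers exactly one element of $L$ (equivalently, $a=\bigvee X$ implies $a\in X$); $\mathrm{sji}(L)$ is the set of such elements and $\mu_L:\mathrm{sji}(L)\to L$ the inclusion. ${\cal H}(L,\mu_L)$ is the simplicial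 complex with vertex set $\mathrm{sji}(L)$ whose faces are the subsets $X$ admitting an enumeration $x_1,\dots,x_k$ and a chain $\ell_0<\ell_1<\cdots<\ell_k$ in $L$ with $\ell_{i-1}<\ell_{i-1}\vee x_i\le\ell_i$ for $i=1,\dots,k$. Two simplicial complexes $(A,H)$, $(A',H')$ are isomorphic if there is a bijection $\varphi:A\to A'$ with $X\in H\iff X\varphi\in H'$ for all $X\subseteq A$. -}

module Defs where

open import Level using (0ℓ)
open import Data.Nat using (ℕ; _<_)
open import Data.Nat.Primality using (Prime)
open import Data.Fin using (Fin)
open import Data.Fin.Subset using (Subset; _∈_; _∉_; _∪_; ⁅_⁆; ⊥; ∣_∣)
open import Data.List using (List; []; _∷_; map)
open import Data.List.Relation.Unary.All using (All)
open import Data.List.Relation.Unary.Unique.Propositional using (Unique)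
open import Data.List.Relation.Binary.Permutation.Propositional using (_↭_)
open import Data.Product using (Σ; ∃; _×_; _,_)
open import Data.Sum using (_⊎_)
open import Data.Unit using (⊤)
open import Function.Bundles using (_⇔_)
open import Relation.Nullary using (¬_)
open import Relation.Unary using (Pred)
open import Relation.Binary.PropositionalEquality using (_≡_)
open import Algebra.Core using (Op₂)

_⊆ₚ_ : ∀ {n} → Pred (Fin n) 0ℓ → Pred (Fin n) 0ℓ → Set
P ⊆ₚ Q = ∀ x → P x → Q x

_⊂ₚ_ : ∀ {n} → Pred (Fin n) 0ℓ → Pred (Fin n) 0ℓ → Set
P ⊂ₚ Q = P ⊆ₚ Q × ∃ λ x → Q x × ¬ P x

⟦_⟧ : ∀ {n} → Subset n → Pred (Fin n) 0ℓ
⟦ A ⟧ x = x ∈ A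

-- Simplicial complexes (vertex set given by a predicate on a type of
-- candidate vertices, faces = finite sets of vertices given as duplicate
-- free lists of vertices satisfying the face predicate) and isomorphisms.

record Complex (V : Set) : Set₁ where
  field
    Vertex : V → Set
    Face   : List V → Set

open Complex public

record IsIso {V V' : Set} (K : Complex V) (K' : Complex V') (φ : V → V') : Set where
  field
    maps-to   : ∀ v → Vertex K v → Vertex K' (φ v)
    injective : ∀ v w → Vertex K v → Vertex K w → φ v ≡ φ w → v ≡ w
    surjective : ∀ v' → Vertex K' v' → ∃ λ v → Vertex K v × φ v ≡ v'
    faces     : ∀ (X : List V) → All (Vertex K) X → Unique X →
                (Face K X ⇔ Face K' (map φ X))

Isomorphic : {V V' : Set} → Complex V → Complex V' → Set
Isomorphic {V} {V'} K K' = Σ (V → V') (IsIso K K')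

module _ {n : ℕ} (_∙_ : Op₂ (Fin n)) where

  -- Y⁺ : the subsemigroup generated by Y (least subset containing Y and
  -- closed under _∙_); Gen Y x means x ∈ Y⁺.  Gen ⊥ is empty.
  data Gen (Y : Subset n) : Fin n → Set where
    gen : ∀ {x} → x ∈ Y → Gen Y x
    mul : ∀ {a b} → Gen Y a → Gen Y b → Gen Y (a ∙ b)

  Cyc : Fin n → Pred (Fin n) 0ℓ
  Cyc s = Gen ⁅ s ⁆

  -- A is a subsemigroup (possibly empty)
  IsSubsemigroup : Subset n → Set
  IsSubsemigroup A = ∀ a b → a ∈ A → b ∈ A → (a ∙ b) ∈ A

  IsSubgroup : Subset n → Set
  IsSubgroup G =
    IsSubsemigroup G ×
    ∃ λ e → e ∈ G ×
      (∀ g → g ∈ G → (e ∙ g ≡ g) × (g ∙ e ≡ g)) ×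
      (∀ g → g ∈ G → ∃ λ h → h ∈ G × (g ∙ h ≡ e) × (h ∙ g ≡ e))

  NontrivialSubgroupsPrime : Set
  NontrivialSubgroupsPrime = ∀ G → IsSubgroup G → 1 < ∣ G ∣ → Prime ∣ G ∣

  Aperiodic : Set
  Aperiodic = ∀ G → IsSubgroup G → ∣ G ∣ ≡ 1

  IsCyclic : Subset n → Set
  IsCyclic A = ∃ λ s → ∀ x → x ∈ A ⇔ Cyc s x

  -- The lattice Sub(S): elements are subsemigroups, order = inclusion,
  -- join of ℓ and x is (ℓ ∪ x)⁺.

  Covers : Subset n → Subset n → Set
  Covers A B = IsSubsemigroup A × IsSubsemigroup B × (⟦ B ⟧ ⊂ₚ ⟦ A ⟧) ×
               (∀ C → IsSubsemigroup C → ¬ ((⟦ B ⟧ ⊂ₚ ⟦ C ⟧) × (⟦ C ⟧ ⊂ₚ ⟦ A ⟧)))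

  -- strictly join irreducible elements of Sub(S): cover exactly one element
  IsSji : Subset n → Set
  IsSji A = IsSubsemigroup A × ∃ λ B → Covers A B × (∀ B' → Covers A B' → B' ≡ B)

  -- Chains used for the faces of H(S) and H₀(S):
  -- given acc = C₁ ∪ … ∪ Cᵢ, require (acc)⁺ ⊂ (acc ∪ Cᵢ₊₁)⁺ at each step.
  StrictGenChain : Subset n → List (Subset n) → Set
  StrictGenChain acc [] = ⊤
  StrictGenChain acc (C ∷ Cs) = (Gen acc ⊂ₚ Gen (acc ∪ C)) × StrictGenChain (acc ∪ C) Cs

  -- Chains for H(L, μ_L) with L = Sub(S): the chain ℓ₀ < ℓ₁ < … < ℓ_k
  -- with ℓ_{i-1} < ℓ_{i-1} ∨ xᵢ ≤ ℓᵢ, where ∨ in Sub(S) is (ℓ ∪ x)⁺.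
  LatChain : Subset n → List (Subset n) → Set
  LatChain ℓ [] = ⊤
  LatChain ℓ (x ∷ xs) =
    ∃ λ ℓ' → IsSubsemigroup ℓ' ×
      (⟦ ℓ ⟧ ⊂ₚ Gen (ℓ ∪ x)) × (Gen (ℓ ∪ x) ⊆ₚ ⟦ ℓ' ⟧) × LatChain ℓ' xs

  -- H(S): vertex set S, faces admit an enumeration with strict chain
  -- ∅ ⊂ {x₁}⁺ ⊂ {x₁,x₂}⁺ ⊂ …
  HS : Complex (Fin n)
  HS = record
    { Vertex = λ _ → ⊤
    ; Face   = λ X → ∃ λ L → (L ↭ X) × StrictGenChain ⊥ (map ⁅_⁆ L) }

  -- H₀(S): vertices are the cyclic subsemigroups, faces admit an
  -- enumeration with C₁ ⊂ (C₁ ∪ C₂)⁺ ⊂ … (and ∅ ⊂ C₁).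
  H0 : Complex (Subset n)
  H0 = record
    { Vertex = IsCyclic
    ; Face   = λ X → ∃ λ L → (L ↭ X) × StrictGenChain ⊥ L }

  HSub : Complex (Subset n)
  HSub = record
    { Vertex = IsSji
    ; Face   = λ X → ∃ λ L → (L ↭ X) × ∃ λ ℓ₀ → IsSubsemigroup ℓ₀ × LatChain ℓ₀ L }

module Submission where

-- The isomorphism H₀(S) → H(Sub(S), μ) is the identity on subsets.
-- Vertices: a subsemigroup is sji in Sub(S) iff it is cyclic.  An sji
-- element A is generated by any s outside its unique lower cover, since a
-- proper s⁺ would lie below some lower cover (finiteness).  Conversely s⁺
-- is sji because it has a greatest proper subsemigroup: s⁺ ∖ {s} if s is
-- not in a subgroup (or s⁺ = {s}), and {e} if s⁺ is a group, which then has
-- prime order p and is generated by each of its non-identity elements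
-- (Bézout).  Faces: strict chains of generated subsemigroups and chains in
-- the lattice Sub(S) translate into each other, joins being (ℓ ∪ x)⁺.
-- For aperiodic S the group s⁺ is trivial whenever s is periodic, which
-- forces s⁺ ≠ t⁺ for s ≠ t; strict chains only depend on the subsemigroups
-- generated, so {s} and s⁺ give the same faces.

open import Defs
open import Level using (0ℓ)
open import Data.Nat using (ℕ; zero; suc; _+_; _*_; _<_; _≤_; z≤n; s≤s)
open import Data.Nat.Properties
  using (≤-trans; <-≤-trans; <-irrefl; +-suc; +-identityʳ; +-assoc; +-comm; *-suc; *-zeroʳ;
         +-cancelʳ-≡; +-monoˡ-≤; m≤n+m; n<1+n; m<n⇒m<1+n; m<1+n⇒m<n∨m≡n; m≤n⇒∃[o]m+o≡n;
         ≤-pred; suc-injective; anyUpTo?)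
open import Data.Nat.Induction using (<-rec)
open import Data.Nat.Coprimality using (Coprime; coprime-Bézout; prime⇒coprime)
open import Data.Nat.Primality using (Prime)
open import Data.Nat.DivMod using (_%_; _/_; m%n<n; m≡m%n+[m/n]*n)
open import Data.Nat.GCD using (module Bézout)
open import Data.Nat.Tactic.RingSolver using (solve-∀)
open import Data.Fin using (Fin) renaming (zero to fzero; suc to fsuc)
open import Data.Fin.Properties using (any?; all?) renaming (_≟_ to _≟ᶠ_)
open import Data.Fin.Subset using (Subset; _∈_; _∉_; _∪_; _-_; ⁅_⁆; ∣_∣; inside; outside)
  renaming (⊥ to ∅)
open import Data.Fin.Subset.Properties
  using (_∈?_; ∉⊥; x∈⁅x⁆; x∈⁅y⁆⇒x≡y; x∈p∪q⁺; x∈p∪q⁻; ∪-identityˡ; ∣⊥∣≡0; ∣p∣≤n;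
         p⊂q⇒∣p∣<∣q∣; ⊆-antisym; anySubset?; x∈p∧x≢y⇒x∈p-y; p─q⊆p)
open import Data.Vec using (_∷_)
open import Data.Vec.Base using (here; there)
open import Data.List using ([]; _∷_; map)
open import Data.List.Properties using (map-id)
open import Data.List.Relation.Unary.All using (All)
open import Data.List.Relation.Unary.Unique.Propositional using (Unique)
open import Data.List.Relation.Binary.Permutation.Propositional using (↭-sym)
open import Data.List.Relation.Binary.Permutation.Propositional.Properties using (↭-map-inv)
import Data.List.Relation.Binary.Permutation.Propositional.Properties as Perm
open import Data.List.Relation.Binary.Pointwise using (Pointwise; []; _∷_)
import Data.List.Relation.Binary.Pointwise as Pointwise
open import Data.Product using (∃; ∃₂; _×_; _,_; proj₁)
open import Data.Sum using (_⊎_; inj₁; inj₂)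
open import Data.Empty using (⊥-elim)
open import Data.Unit using (⊤; tt)
open import Relation.Nullary using (¬_; Dec; yes; no; contradiction)
open import Relation.Nullary.Decidable using (_×-dec_; _→-dec_; ¬?; map′)
open import Relation.Unary using (Pred; Decidable)
open import Relation.Binary.PropositionalEquality
  using (_≡_; _≢_; refl; sym; trans; cong; subst; module ≡-Reasoning)
open import Function.Bundles using (_⇔_; mk⇔; Equivalence)
open import Algebra.Core using (Op₂)
open import Algebra.Structures using (IsSemigroup)

x∉p-x : ∀ {n} (x : Fin n) (p : Subset n) → x ∉ p - x
x∉p-x fzero    (_ ∷ p) ()
x∉p-x (fsuc x) (_ ∷ p) (there x∈) = x∉p-x x p x∈

⁅⁆-⊆ : ∀ {n} {x : Fin n} {P : Subset n} → x ∈ P → ⟦ ⁅ x ⁆ ⟧ ⊆ₚ ⟦ P ⟧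
⁅⁆-⊆ {x = x} {P} x∈P y y∈⁅x⁆ = subst (_∈ P) (sym (x∈⁅y⁆⇒x≡y x y∈⁅x⁆)) x∈P

⊆ₚ-trans : ∀ {n} {P Q R : Pred (Fin n) 0ℓ} → P ⊆ₚ Q → Q ⊆ₚ R → P ⊆ₚ R
⊆ₚ-trans P⊆Q Q⊆R x x∈P = Q⊆R x (P⊆Q x x∈P)

∪ˡ : ∀ {n} (P Q : Subset n) → ⟦ P ⟧ ⊆ₚ ⟦ P ∪ Q ⟧
∪ˡ P Q x x∈P = x∈p∪q⁺ (inj₁ x∈P)

∪ʳ : ∀ {n} (P Q : Subset n) → ⟦ Q ⟧ ⊆ₚ ⟦ P ∪ Q ⟧
∪ʳ P Q x x∈Q = x∈p∪q⁺ (inj₂ x∈Q)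

∪-⊆ : ∀ {n} {P Q : Subset n} {R : Pred (Fin n) 0ℓ} → ⟦ P ⟧ ⊆ₚ R → ⟦ Q ⟧ ⊆ₚ R → ⟦ P ∪ Q ⟧ ⊆ₚ R
∪-⊆ {P = P} {Q} P⊆R Q⊆R x x∈P∪Q with x∈p∪q⁻ P Q x∈P∪Q
... | inj₁ x∈P = P⊆R x x∈P
... | inj₂ x∈Q = Q⊆R x x∈Q

⊆-or-witness : ∀ {n} (P Q : Subset n) → ⟦ P ⟧ ⊆ₚ ⟦ Q ⟧ ⊎ ∃ λ x → x ∈ P × x ∉ Q
⊆-or-witness P Q with any? (λ x → x ∈? P ×-dec ¬? (x ∈? Q))
... | yes witness = inj₂ witness
... | no none     = inj₁ λ x x∈P → decide x x∈P (x ∈? Q)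
  where
  decide : ∀ x → x ∈ P → Dec (x ∈ Q) → x ∈ Q
  decide x _   (yes x∈Q) = x∈Q
  decide x x∈P (no x∉Q)  = ⊥-elim (none (x , x∈P , x∉Q))

⊆-or-⊂ : ∀ {n} {P Q : Subset n} → ⟦ P ⟧ ⊆ₚ ⟦ Q ⟧ → P ≡ Q ⊎ ⟦ P ⟧ ⊂ₚ ⟦ Q ⟧
⊆-or-⊂ {P = P} {Q} P⊆Q with ⊆-or-witness Q P
... | inj₁ Q⊆P   = inj₁ (⊆-antisym (λ {x} → P⊆Q x) (λ {x} → Q⊆P x))
... | inj₂ extra = inj₂ (P⊆Q , extra)

⊂? : ∀ {n} (P Q : Subset n) → Dec (⟦ P ⟧ ⊂ₚ ⟦ Q ⟧)
⊂? P Q = (all? λ x → x ∈? P →-dec x ∈? Q) ×-dec any? (λ x → x ∈? Q ×-dec ¬? (x ∈? P))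

⊂ₚ⇒∣<∣ : ∀ {n} {P Q : Subset n} → ⟦ P ⟧ ⊂ₚ ⟦ Q ⟧ → ∣ P ∣ < ∣ Q ∣
⊂ₚ⇒∣<∣ (P⊆Q , new) = p⊂q⇒∣p∣<∣q∣ ((λ {x} → P⊆Q x) , new)

-- Strictly ascending chains of subsets of Fin n have length at most n.
ascend : ∀ {n} (P Q : Subset n → Set) →
         (∀ T → P T → Q T ⊎ ∃ λ T' → P T' × ⟦ T ⟧ ⊂ₚ ⟦ T' ⟧) →
         ∀ T → P T → ∃ λ T' → P T' × Q T'
ascend {n} P Q step T₀ = climb n T₀ (m≤n+m n ∣ T₀ ∣)
  where
  -- k bounds the number of remaining strict enlargements
  climb : ∀ k T → n ≤ ∣ T ∣ + k → P T → ∃ λ T' → P T' × Q T'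
  climb k T bound pT with step T pT
  ... | inj₁ qT = T , pT , qT
  climb zero T bound pT | inj₂ (T' , _ , T⊂T') =
    ⊥-elim (<-irrefl refl (<-≤-trans (⊂ₚ⇒∣<∣ T⊂T')
      (≤-trans (∣p∣≤n T') (subst (n ≤_) (+-identityʳ ∣ T ∣) bound))))
  climb (suc k) T bound pT | inj₂ (T' , pT' , T⊂T') =
    climb k T' (≤-trans bound (subst (_≤ ∣ T' ∣ + k) (sym (+-suc ∣ T ∣ k))
                                     (+-monoˡ-≤ k (⊂ₚ⇒∣<∣ T⊂T')))) pT'

∣⁅x⁆∪p∣ : ∀ {n} (x : Fin n) (p : Subset n) → x ∉ p → ∣ ⁅ x ⁆ ∪ p ∣ ≡ suc ∣ p ∣
∣⁅x⁆∪p∣ fzero    (outside ∷ p) _   = cong suc (cong ∣_∣ (∪-identityˡ p))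
∣⁅x⁆∪p∣ fzero    (inside  ∷ p) x∉p = contradiction here x∉p
∣⁅x⁆∪p∣ (fsuc x) (inside  ∷ p) x∉p = cong suc (∣⁅x⁆∪p∣ x p (λ x∈p → x∉p (there x∈p)))
∣⁅x⁆∪p∣ (fsuc x) (outside ∷ p) x∉p = ∣⁅x⁆∪p∣ x p (λ x∈p → x∉p (there x∈p))

image : ∀ {n} → (ℕ → Fin n) → ℕ → Subset n
image f zero    = ∅
image f (suc k) = ⁅ f k ⁆ ∪ image f k

image⁻ : ∀ {n} (f : ℕ → Fin n) k {x} → x ∈ image f k → ∃ λ i → i < k × f i ≡ x
image⁻ f zero    x∈ = ⊥-elim (∉⊥ x∈)
image⁻ f (suc k) x∈ with x∈p∪q⁻ ⁅ f k ⁆ (image f k) x∈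
... | inj₁ x∈⁅fk⁆ = k , n<1+n k , sym (x∈⁅y⁆⇒x≡y (f k) x∈⁅fk⁆)
... | inj₂ x∈img with image⁻ f k x∈img
...   | i , i<k , fi≡x = i , m<n⇒m<1+n i<k , fi≡x

image⁺ : ∀ {n} (f : ℕ → Fin n) k {i} → i < k → f i ∈ image f k
image⁺ f (suc k) {i} i<1+k with m<1+n⇒m<n∨m≡n i<1+k
... | inj₁ i<k  = x∈p∪q⁺ (inj₂ (image⁺ f k i<k))
... | inj₂ refl = x∈p∪q⁺ (inj₁ (x∈⁅x⁆ (f i)))

∣image∣ : ∀ {n} (f : ℕ → Fin n) k → (∀ i j → i < j → j < k → f i ≢ f j) → ∣ image f k ∣ ≡ k
∣image∣ {n} f zero _ = ∣⊥∣≡0 n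
∣image∣ f (suc k) inj = trans (∣⁅x⁆∪p∣ (f k) (image f k) fk∉) (cong suc (∣image∣ f k inj<k))
  where
  inj<k : ∀ i j → i < j → j < k → f i ≢ f j
  inj<k i j i<j j<k = inj i j i<j (m<n⇒m<1+n j<k)
  fk∉ : f k ∉ image f k
  fk∉ fk∈ with image⁻ f k fk∈
  ... | i , i<k , fi≡fk = inj i k i<k (n<1+n k) fi≡fk

Least : (ℕ → Set) → Set
Least P = ∃ λ m → P m × (∀ d → d < m → ¬ P d)

least : (P : ℕ → Set) → Decidable P → ∀ k → P k → Least P
least P P? = <-rec (λ k → P k → Least P) step
  where
  step : ∀ k → (∀ {d} → d < k → P d → Least P) → P k → Least P
  step k below pk with anyUpTo? P? k
  ... | yes (d , d<k , pd) = below d<k pd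
  ... | no none            = k , pk , λ d d<k pd → none (d , d<k , pd)

-- From Bézout either y * j = 1 + x * m directly, or 1 + y * j = x * m; in
-- the latter case (1 + (1 + y) * m') * j ≡ 1 (mod m) where m = 1 + m'.
multiple≡1 : ∀ {m j} → Coprime m j → 0 < j → ∃₂ λ t c → suc t * j ≡ 1 + c * m
multiple≡1 {m} {j} cop 0<j with coprime-Bézout cop
... | Bézout.-+ x (suc t) eq = t , x , sym eq
... | Bézout.-+ x zero    ()
... | Bézout.+- x y eq with m | j
...   | zero   | _       = contradiction (trans eq (*-zeroʳ x)) λ ()
...   | suc m' | suc j'  = m' + y * m' , j' + m' * x , +-cancelʳ-≡ (suc m') _ _ shifted
  where
  open ≡-Reasoning
  expand : ∀ y j' m' → suc (m' + y * m') * suc j' + suc m' ≡ 1 + m' * (1 + y * suc j') + suc j' * suc m'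
  expand = solve-∀
  regroup : ∀ x j' m' → 1 + m' * (x * suc m') + suc j' * suc m' ≡ 1 + (j' + m' * x) * suc m' + suc m'
  regroup = solve-∀
  shifted : suc (m' + y * m') * suc j' + suc m' ≡ 1 + (j' + m' * x) * suc m' + suc m'
  shifted = begin
    suc (m' + y * m') * suc j' + suc m'       ≡⟨ expand y j' m' ⟩
    1 + m' * (1 + y * suc j') + suc j' * suc m' ≡⟨ cong (λ z → 1 + m' * z + suc j' * suc m') eq ⟩
    1 + m' * (x * suc m') + suc j' * suc m'    ≡⟨ regroup x j' m' ⟩
    1 + (j' + m' * x) * suc m' + suc m'        ∎

-- Facts about generated subsemigroups and the lattice Sub(S) that hold for
-- any binary operation.
module Generation {n : ℕ} (_∙_ : Op₂ (Fin n)) where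

  ⟨_⟩ : Subset n → Pred (Fin n) 0ℓ
  ⟨ Y ⟩ = Gen _∙_ Y

  Closed : Pred (Fin n) 0ℓ → Set
  Closed P = ∀ a b → P a → P b → P (a ∙ b)

  ⁺-least : ∀ {Y} (P : Pred (Fin n) 0ℓ) → Closed P → ⟦ Y ⟧ ⊆ₚ P → ⟨ Y ⟩ ⊆ₚ P
  ⁺-least P closed Y⊆P x (gen x∈Y) = Y⊆P x x∈Y
  ⁺-least P closed Y⊆P _ (mul {a} {b} ga gb) =
    closed a b (⁺-least P closed Y⊆P a ga) (⁺-least P closed Y⊆P b gb)

  ⁺-sub : ∀ {Y Z} → ⟦ Y ⟧ ⊆ₚ ⟨ Z ⟩ → ⟨ Y ⟩ ⊆ₚ ⟨ Z ⟩
  ⁺-sub {Z = Z} = ⁺-least ⟨ Z ⟩ (λ _ _ → mul)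

  ⁺-mono : ∀ {Y Z} → ⟦ Y ⟧ ⊆ₚ ⟦ Z ⟧ → ⟨ Y ⟩ ⊆ₚ ⟨ Z ⟩
  ⁺-mono Y⊆Z = ⁺-sub λ x x∈Y → gen (Y⊆Z x x∈Y)

  _≐⁺_ : Subset n → Subset n → Set
  A ≐⁺ Y = ∀ x → x ∈ A ⇔ ⟨ Y ⟩ x

  ≐⁺-subsemigroup : ∀ {A Y} → A ≐⁺ Y → IsSubsemigroup _∙_ A
  ≐⁺-subsemigroup A≐ a b a∈ b∈ =
    Equivalence.from (A≐ _) (mul (Equivalence.to (A≐ a) a∈) (Equivalence.to (A≐ b) b∈))

  ≐⁺-base : ∀ {A Y} → A ≐⁺ Y → ⟦ Y ⟧ ⊆ₚ ⟦ A ⟧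
  ≐⁺-base A≐ x x∈Y = Equivalence.from (A≐ x) (gen x∈Y)

  closed-or-escape : ∀ T → IsSubsemigroup _∙_ T ⊎ ∃₂ λ a b → a ∈ T × b ∈ T × a ∙ b ∉ T
  closed-or-escape T with any? (λ a → any? λ b → a ∈? T ×-dec b ∈? T ×-dec ¬? (a ∙ b ∈? T))
  ... | yes (a , b , escape) = inj₂ (a , b , escape)
  ... | no none              = inj₁ closed
    where
    closed : IsSubsemigroup _∙_ T
    closed a b a∈ b∈ with a ∙ b ∈? T
    ... | yes ab∈ = ab∈
    ... | no ab∉  = ⊥-elim (none (a , b , a∈ , b∈ , ab∉))

  subsemigroup? : ∀ T → Dec (IsSubsemigroup _∙_ T)
  subsemigroup? T with closed-or-escape T
  ... | inj₁ closed                  = yes closed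
  ... | inj₂ (a , b , a∈ , b∈ , ab∉) = no λ closed → ab∉ (closed a b a∈ b∈)

  -- Every Y⁺ is carried by a finite subset: add escaping products to Y
  -- until the set is closed.
  closure : ∀ Y → ∃ λ A → A ≐⁺ Y
  closure Y = finish (ascend Between (IsSubsemigroup _∙_) enlarge Y ((λ _ y → y) , (λ _ → gen)))
    where
    Between : Subset n → Set
    Between T = ⟦ Y ⟧ ⊆ₚ ⟦ T ⟧ × ⟦ T ⟧ ⊆ₚ ⟨ Y ⟩
    finish : (∃ λ A → Between A × IsSubsemigroup _∙_ A) → ∃ λ A → A ≐⁺ Y
    finish (A , (Y⊆A , A⊆Y⁺) , closed) = A , λ x → mk⇔ (A⊆Y⁺ x) (⁺-least ⟦ A ⟧ closed Y⊆A x)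
    enlarge : ∀ T → Between T → IsSubsemigroup _∙_ T ⊎ ∃ λ T' → Between T' × ⟦ T ⟧ ⊂ₚ ⟦ T' ⟧
    enlarge T (Y⊆T , T⊆Y⁺) with closed-or-escape T
    ... | inj₁ closed = inj₁ closed
    ... | inj₂ (a , b , a∈ , b∈ , ab∉) =
      inj₂ (⁅ a ∙ b ⁆ ∪ T
           , (⊆ₚ-trans Y⊆T (∪ʳ _ T) , ∪-⊆ new⊆Y⁺ T⊆Y⁺)
           , (∪ʳ _ T , a ∙ b , ∪ˡ ⁅ a ∙ b ⁆ T _ (x∈⁅x⁆ (a ∙ b)) , ab∉))
      where
      new⊆Y⁺ : ⟦ ⁅ a ∙ b ⁆ ⟧ ⊆ₚ ⟨ Y ⟩
      new⊆Y⁺ x x∈ = subst ⟨ Y ⟩ (sym (x∈⁅y⁆⇒x≡y (a ∙ b) x∈)) (mul (T⊆Y⁺ a a∈) (T⊆Y⁺ b b∈))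

  _≈⁺_ : Subset n → Subset n → Set
  Y ≈⁺ Z = ⟦ Y ⟧ ⊆ₚ ⟨ Z ⟩ × ⟦ Z ⟧ ⊆ₚ ⟨ Y ⟩

  ≈⁺-refl : ∀ {Y} → Y ≈⁺ Y
  ≈⁺-refl = (λ _ → gen) , (λ _ → gen)

  ≈⁺-sym : ∀ {Y Z} → Y ≈⁺ Z → Z ≈⁺ Y
  ≈⁺-sym (Y⊆ , Z⊆) = Z⊆ , Y⊆

  ≐⁺⇒≈⁺ : ∀ {A Y} → A ≐⁺ Y → Y ≈⁺ A
  ≐⁺⇒≈⁺ A≐ = (λ x x∈Y → gen (≐⁺-base A≐ x x∈Y)) , (λ x x∈A → Equivalence.to (A≐ x) x∈A)

  ≈⁺-∪ : ∀ {Y Y' Z Z'} → Y ≈⁺ Y' → Z ≈⁺ Z' → (Y ∪ Z) ≈⁺ (Y' ∪ Z')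
  ≈⁺-∪ {Y} {Y'} {Z} {Z'} (Y⊆ , Y'⊆) (Z⊆ , Z'⊆) =
    ∪-⊆ (⊆ₚ-trans Y⊆ (⁺-mono (∪ˡ Y' Z'))) (⊆ₚ-trans Z⊆ (⁺-mono (∪ʳ Y' Z'))) ,
    ∪-⊆ (⊆ₚ-trans Y'⊆ (⁺-mono (∪ˡ Y Z))) (⊆ₚ-trans Z'⊆ (⁺-mono (∪ʳ Y Z)))

  ⊂-resp-≈⁺ : ∀ {Y Y' Z Z'} → Y ≈⁺ Y' → Z ≈⁺ Z' → ⟨ Y ⟩ ⊂ₚ ⟨ Z ⟩ → ⟨ Y' ⟩ ⊂ₚ ⟨ Z' ⟩
  ⊂-resp-≈⁺ (_ , Y'⊆) (Z⊆ , _) (Y⁺⊆Z⁺ , x , x∈Z⁺ , x∉Y⁺) =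
    ⊆ₚ-trans (⁺-sub Y'⊆) (⊆ₚ-trans Y⁺⊆Z⁺ (⁺-sub Z⊆)) ,
    x , ⁺-sub Z⊆ x x∈Z⁺ , λ x∈Y'⁺ → x∉Y⁺ (⁺-sub Y'⊆ x x∈Y'⁺)

  chain-resp-≈⁺ : ∀ {acc acc' Cs Cs'} → acc ≈⁺ acc' → Pointwise _≈⁺_ Cs Cs' →
                  StrictGenChain _∙_ acc Cs → StrictGenChain _∙_ acc' Cs'
  chain-resp-≈⁺ _     []          _             = tt
  chain-resp-≈⁺ {acc} {acc'} {C ∷ _} {C' ∷ _} acc≈ (C≈ ∷ Cs≈) (step , rest) =
    ⊂-resp-≈⁺ acc≈ acc∪C≈ step , chain-resp-≈⁺ acc∪C≈ Cs≈ rest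
    where
    acc∪C≈ : (acc ∪ C) ≈⁺ (acc' ∪ C')
    acc∪C≈ = ≈⁺-∪ acc≈ C≈

  ∅-closed : IsSubsemigroup _∙_ ∅
  ∅-closed a b a∈∅ = ⊥-elim (∉⊥ a∈∅)

  escape : ∀ {ℓ C y} → IsSubsemigroup _∙_ ℓ → ⟨ ℓ ∪ C ⟩ y → y ∉ ℓ → ∃ λ z → z ∈ C × z ∉ ℓ
  escape {ℓ} {C} ℓ-closed y∈ y∉ with ⊆-or-witness C ℓ
  ... | inj₂ witness = witness
  ... | inj₁ C⊆ℓ     = ⊥-elim (y∉ (⁺-least ⟦ ℓ ⟧ ℓ-closed (∪-⊆ (λ _ x∈ → x∈) C⊆ℓ) _ y∈))

  -- A strict chain starting at a subsemigroup ℓ is a chain in the lattice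
  -- Sub(S), taking ℓᵢ to be the subsemigroup generated so far.
  strict⇒lattice : ∀ ℓ Cs → IsSubsemigroup _∙_ ℓ → StrictGenChain _∙_ ℓ Cs → LatChain _∙_ ℓ Cs
  strict⇒lattice ℓ []       _        _                           = tt
  strict⇒lattice ℓ (C ∷ Cs) ℓ-closed ((_ , y , y∈ , y∉) , rest) with closure (ℓ ∪ C)
  ... | ℓ' , ℓ'≐ =
    ℓ' , ≐⁺-subsemigroup ℓ'≐ , below , (λ x → Equivalence.from (ℓ'≐ x)) ,
    strict⇒lattice ℓ' Cs (≐⁺-subsemigroup ℓ'≐)
      (chain-resp-≈⁺ (≐⁺⇒≈⁺ ℓ'≐) (Pointwise.refl ≈⁺-refl) rest)
    where
    below : ⟦ ℓ ⟧ ⊂ₚ ⟨ ℓ ∪ C ⟩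
    below = (λ x x∈ℓ → gen (∪ˡ ℓ C x x∈ℓ)) , y , y∈ , λ y∈ℓ → y∉ (gen y∈ℓ)

  -- Conversely a chain in Sub(S) above the subsemigroups generated so far
  -- gives a strict chain: each new element xᵢ escapes the previous ℓᵢ₋₁.
  lattice⇒strict : ∀ acc ℓ Cs → IsSubsemigroup _∙_ ℓ → ⟦ acc ⟧ ⊆ₚ ⟦ ℓ ⟧ →
                   LatChain _∙_ ℓ Cs → StrictGenChain _∙_ acc Cs
  lattice⇒strict acc ℓ [] _ _ _ = tt
  lattice⇒strict acc ℓ (C ∷ Cs) ℓ-closed acc⊆ℓ (ℓ' , ℓ'-closed , (_ , y , y∈ , y∉) , join⊆ℓ' , rest)
    with escape ℓ-closed y∈ y∉
  ... | z , z∈C , z∉ℓ =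
    (⁺-mono (∪ˡ acc C) , z , gen (∪ʳ acc C z z∈C) ,
     λ z∈acc⁺ → z∉ℓ (⁺-least ⟦ ℓ ⟧ ℓ-closed acc⊆ℓ z z∈acc⁺)) ,
    lattice⇒strict (acc ∪ C) ℓ' Cs ℓ'-closed acc∪C⊆ℓ' rest
    where
    acc∪C⊆ℓ' : ⟦ acc ∪ C ⟧ ⊆ₚ ⟦ ℓ' ⟧
    acc∪C⊆ℓ' = ⊆ₚ-trans (∪-⊆ (⊆ₚ-trans acc⊆ℓ (∪ˡ ℓ C)) (∪ʳ ℓ C)) (⊆ₚ-trans (λ _ → gen) join⊆ℓ')

  strict⇔lattice : ∀ Cs → StrictGenChain _∙_ ∅ Cs ⇔ (∃ λ ℓ₀ → IsSubsemigroup _∙_ ℓ₀ × LatChain _∙_ ℓ₀ Cs)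
  strict⇔lattice Cs = mk⇔
    (λ chain → ∅ , ∅-closed , strict⇒lattice ∅ Cs ∅-closed chain)
    (λ { (ℓ₀ , ℓ₀-closed , chain) → lattice⇒strict ∅ ℓ₀ Cs ℓ₀-closed (λ _ x∈∅ → ⊥-elim (∉⊥ x∈∅)) chain })

  greatest-proper⇒sji : ∀ {A B} → IsSubsemigroup _∙_ A → IsSubsemigroup _∙_ B → ⟦ B ⟧ ⊂ₚ ⟦ A ⟧ →
    (∀ C → IsSubsemigroup _∙_ C → ⟦ C ⟧ ⊂ₚ ⟦ A ⟧ → ⟦ C ⟧ ⊆ₚ ⟦ B ⟧) → IsSji _∙_ A
  greatest-proper⇒sji {A} {B} A-closed B-closed B⊂A greatest = A-closed , B , covers , unique
    where
    covers : Covers _∙_ A B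
    covers = A-closed , B-closed , B⊂A ,
      λ { C C-closed ((_ , y , y∈C , y∉B) , C⊂A) → y∉B (greatest C C-closed C⊂A y y∈C) }
    unique : ∀ B' → Covers _∙_ A B' → B' ≡ B
    unique B' (_ , B'-closed , B'⊂A , nothing-between) with ⊆-or-⊂ (greatest B' B'-closed B'⊂A)
    ... | inj₁ B'≡B = B'≡B
    ... | inj₂ B'⊂B = ⊥-elim (nothing-between B B-closed (B'⊂B , B⊂A))

  below-cover : ∀ {A C} → IsSubsemigroup _∙_ A → IsSubsemigroup _∙_ C → ⟦ C ⟧ ⊂ₚ ⟦ A ⟧ →
                ∃ λ D → ⟦ C ⟧ ⊆ₚ ⟦ D ⟧ × Covers _∙_ A D
  below-cover {A} {C} A-closed C-closed C⊂A =
    finish (ascend Between (Covers _∙_ A) raise C ((λ _ x∈ → x∈) , C-closed , C⊂A))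
    where
    Between : Subset n → Set
    Between D = ⟦ C ⟧ ⊆ₚ ⟦ D ⟧ × IsSubsemigroup _∙_ D × ⟦ D ⟧ ⊂ₚ ⟦ A ⟧
    finish : (∃ λ D → Between D × Covers _∙_ A D) → ∃ λ D → ⟦ C ⟧ ⊆ₚ ⟦ D ⟧ × Covers _∙_ A D
    finish (D , (C⊆D , _) , covers) = D , C⊆D , covers
    raise : ∀ D → Between D → Covers _∙_ A D ⊎ ∃ λ D' → Between D' × ⟦ D ⟧ ⊂ₚ ⟦ D' ⟧
    raise D (C⊆D , D-closed , D⊂A)
      with anySubset? (λ D' → subsemigroup? D' ×-dec ⊂? D D' ×-dec ⊂? D' A)
    ... | yes (D' , D'-closed , D⊂D' , D'⊂A) =
      inj₂ (D' , (⊆ₚ-trans C⊆D (proj₁ D⊂D') , D'-closed , D'⊂A) , D⊂D')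
    ... | no none =
      inj₁ (A-closed , D-closed , D⊂A ,
            λ D' D'-closed (D⊂D' , D'⊂A) → none (D' , D'-closed , D⊂D' , D'⊂A))

  generator⁺⊆ : ∀ {A s} → IsSubsemigroup _∙_ A → s ∈ A → ⟨ ⁅ s ⁆ ⟩ ⊆ₚ ⟦ A ⟧
  generator⁺⊆ {A} A-closed s∈A = ⁺-least ⟦ A ⟧ A-closed (⁅⁆-⊆ s∈A)

  -- Every sji element A of Sub(S) is cyclic, generated by any element s
  -- outside its lower cover: otherwise s⁺ would lie below that lower cover.
  sji⇒cyclic : ∀ A → IsSji _∙_ A → IsCyclic _∙_ A
  sji⇒cyclic A (A-closed , B , (_ , _ , (_ , s , s∈A , s∉B) , _) , unique) = generated-by (closure ⁅ s ⁆)
    where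
    generated-by : (∃ λ T → T ≐⁺ ⁅ s ⁆) → IsCyclic _∙_ A
    generated-by (T , T≐) with ⊆-or-⊂ (⊆ₚ-trans (λ x → Equivalence.to (T≐ x)) (generator⁺⊆ A-closed s∈A))
    ... | inj₁ refl = s , T≐
    ... | inj₂ T⊂A with below-cover A-closed (≐⁺-subsemigroup T≐) T⊂A
    ...   | D , T⊆D , covers = ⊥-elim (s∉B (subst (s ∈_) (unique D covers) (T⊆D s (≐⁺-base T≐ s (x∈⁅x⁆ s)))))

  generator∉proper : ∀ {A C s} → A ≐⁺ ⁅ s ⁆ → IsSubsemigroup _∙_ C → ⟦ C ⟧ ⊂ₚ ⟦ A ⟧ → s ∉ C
  generator∉proper A≐ C-closed (_ , z , z∈A , z∉C) s∈C =
    z∉C (generator⁺⊆ C-closed s∈C z (Equivalence.to (A≐ z) z∈A))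

  removable-generator⇒sji : ∀ {A s} → A ≐⁺ ⁅ s ⁆ → IsSubsemigroup _∙_ (A - s) → IsSji _∙_ A
  removable-generator⇒sji {A} {s} A≐ rest-closed =
    greatest-proper⇒sji (≐⁺-subsemigroup A≐) rest-closed
      ((λ _ x∈ → p─q⊆p A ⁅ s ⁆ x∈) , s , ≐⁺-base A≐ s (x∈⁅x⁆ s) , x∉p-x s A)
      λ C C-closed C⊂A x x∈C →
        x∈p∧x≢y⇒x∈p-y (proj₁ C⊂A x x∈C) λ { refl → generator∉proper A≐ C-closed C⊂A x∈C }

  singleton-removable : ∀ {A s} → (∀ x → x ∈ A → x ≡ s) → IsSubsemigroup _∙_ (A - s)
  singleton-removable {A} {s} only-s a b a∈ _ =
    ⊥-elim (x∉p-x s A (subst (_∈ A - s) (only-s a (p─q⊆p A ⁅ s ⁆ a∈)) a∈))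

module Cyclic {n : ℕ} (_∙_ : Op₂ (Fin n)) (assoc : ∀ x y z → (x ∙ y) ∙ z ≡ x ∙ (y ∙ z)) where
  open Generation _∙_

  module Powers (s : Fin n) where

    -- pow k = s^(k+1)
    pow : ℕ → Fin n
    pow zero    = s
    pow (suc k) = pow k ∙ s

    pow-add : ∀ a b → pow (suc (a + b)) ≡ pow a ∙ pow b
    pow-add a zero    = cong (λ k → pow k ∙ s) (+-identityʳ a)
    pow-add a (suc b) = begin
      pow (a + suc b) ∙ s    ≡⟨ cong (λ k → pow k ∙ s) (+-suc a b) ⟩
      pow (suc (a + b)) ∙ s  ≡⟨ cong (_∙ s) (pow-add a b) ⟩
      (pow a ∙ pow b) ∙ s    ≡⟨ assoc (pow a) (pow b) s ⟩
      pow a ∙ (pow b ∙ s)    ∎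
      where open ≡-Reasoning

    pow∈ : ∀ k → ⟨ ⁅ s ⁆ ⟩ (pow k)
    pow∈ zero    = gen (x∈⁅x⁆ s)
    pow∈ (suc k) = mul (pow∈ k) (gen (x∈⁅x⁆ s))

    ∈⇒pow : ∀ {x} → ⟨ ⁅ s ⁆ ⟩ x → ∃ λ k → pow k ≡ x
    ∈⇒pow (gen x∈⁅s⁆) = 0 , sym (x∈⁅y⁆⇒x≡y s x∈⁅s⁆)
    ∈⇒pow (mul a∈ b∈) with ∈⇒pow a∈ | ∈⇒pow b∈
    ... | i , refl | j , refl = suc (i + j) , pow-add i j

    ∈⇒s∙ : ∀ {x} → ⟨ ⁅ s ⁆ ⟩ x → x ≢ s → ∃ λ y → ⟨ ⁅ s ⁆ ⟩ y × x ≡ s ∙ y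
    ∈⇒s∙ x∈ x≢s with ∈⇒pow x∈
    ... | zero  , refl = ⊥-elim (x≢s refl)
    ... | suc k , refl = pow k , pow∈ k , pow-add 0 k

    -- s is periodic when s = s ∙ x for some x ∈ s⁺, i.e. when s⁺ is a group.
    Periodic : Set
    Periodic = ∃ λ x → ⟨ ⁅ s ⁆ ⟩ x × s ∙ x ≡ s

    periodic? : ∀ {A} → A ≐⁺ ⁅ s ⁆ → Dec Periodic
    periodic? {A} A≐ = map′
      (λ { (x , x∈A , sx≡s) → x , Equivalence.to (A≐ x) x∈A , sx≡s })
      (λ { (x , x∈ , sx≡s) → x , Equivalence.from (A≐ x) x∈ , sx≡s })
      (any? λ x → x ∈? A ×-dec (s ∙ x ≟ᶠ s))

    minimal-period : Periodic → Least (λ d → pow (suc d) ≡ s)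
    minimal-period (x , x∈ , sx≡s) with ∈⇒pow x∈
    ... | k , refl = least _ (λ d → pow (suc d) ≟ᶠ s) k (trans (pow-add 0 k) sx≡s)

    -- If s is not periodic then s⁺ ∖ {s} is closed: a product (s ∙ y) ∙ b
    -- equal to s would make s periodic.
    nonperiodic⇒removable : ∀ {A} → A ≐⁺ ⁅ s ⁆ → ¬ Periodic → IsSubsemigroup _∙_ (A - s)
    nonperiodic⇒removable {A} A≐ nonperiodic a b a∈ b∈ =
      x∈p∧x≢y⇒x∈p-y (≐⁺-subsemigroup A≐ a b a∈A b∈A) ab≢s
      where
      a∈A : a ∈ A
      a∈A = p─q⊆p A ⁅ s ⁆ a∈
      b∈A : b ∈ A
      b∈A = p─q⊆p A ⁅ s ⁆ b∈
      ab≢s : a ∙ b ≢ s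
      ab≢s ab≡s with ∈⇒s∙ (Equivalence.to (A≐ a) a∈A) (λ { refl → x∉p-x s A a∈ })
      ... | y , y∈ , refl =
        nonperiodic (y ∙ b , mul y∈ (Equivalence.to (A≐ b) b∈A) , trans (sym (assoc s y b)) ab≡s)

    -- If pow (suc m') = s with m' minimal, then s⁺ is a cyclic group of
    -- order m = m' + 1: its elements are q 0, …, q (m - 1), where
    -- q k = s^(k+m); q turns + into ∙, q 0 is the identity and q 1 = s.
    module Group (m' : ℕ) (period : pow (suc m') ≡ s) (minimal : ∀ d → d < m' → pow (suc d) ≢ s) where

      m : ℕ
      m = suc m'

      pow-periodic : ∀ k t → pow (k + t * m) ≡ pow k
      pow-periodic k zero    = cong pow (+-identityʳ k)
      pow-periodic k (suc t) = begin
        pow (k + (m + t * m))  ≡⟨ cong pow (sym (+-assoc k m (t * m))) ⟩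
        pow (k + m + t * m)    ≡⟨ pow-periodic (k + m) t ⟩
        pow (k + m)            ≡⟨ once k ⟩
        pow k                  ∎
        where
        open ≡-Reasoning
        once : ∀ k → pow (k + m) ≡ pow k
        once zero    = period
        once (suc k) = cong (_∙ s) (once k)

      q : ℕ → Fin n
      q k = pow (k + m')

      q-one : q 1 ≡ s
      q-one = period

      q-periodic : ∀ a t → q (a + t * m) ≡ q a
      q-periodic a t = trans (cong pow (swap a (t * m) m')) (pow-periodic (a + m') t)
        where
        swap : ∀ a b c → a + b + c ≡ a + c + b
        swap = solve-∀

      q-add : ∀ a b → q (a + b) ≡ q a ∙ q b
      q-add a b = begin
        pow (a + b + m')                  ≡⟨ sym (pow-periodic (a + b + m') 1) ⟩
        pow (a + b + m' + 1 * m)          ≡⟨ cong pow (regroup a b m') ⟩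
        pow (suc (a + m' + (b + m')))     ≡⟨ pow-add (a + m') (b + m') ⟩
        q a ∙ q b                         ∎
        where
        open ≡-Reasoning
        regroup : ∀ a b m' → a + b + m' + 1 * suc m' ≡ suc (a + m' + (b + m'))
        regroup = solve-∀

      pow≡q : ∀ k → pow k ≡ q (suc k)
      pow≡q k = trans (sym (pow-periodic k 1)) (cong pow (shift k m'))
        where
        shift : ∀ k m' → k + 1 * suc m' ≡ suc k + m'
        shift = solve-∀

      q-shift : ∀ a b c → q a ≡ q b → q (a + c) ≡ q (b + c)
      q-shift a b c qa≡qb = trans (q-add a c) (trans (cong (_∙ q c) qa≡qb) (sym (q-add b c)))

      q∈ : ∀ j → ⟨ ⁅ s ⁆ ⟩ (q j)
      q∈ j = pow∈ (j + m')

      q-onto : ∀ {x} → ⟨ ⁅ s ⁆ ⟩ x → ∃ λ j → j < m × q j ≡ x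
      q-onto x∈ with ∈⇒pow x∈
      ... | k , refl = suc k % m , m%n<n (suc k) m , reduce
        where
        reduce : q (suc k % m) ≡ pow k
        reduce = begin
          q (suc k % m)                       ≡⟨ sym (q-periodic (suc k % m) (suc k / m)) ⟩
          q (suc k % m + (suc k / m) * m)     ≡⟨ cong q (sym (m≡m%n+[m/n]*n (suc k) m)) ⟩
          q (suc k)                           ≡⟨ sym (pow≡q k) ⟩
          pow k                               ∎
          where open ≡-Reasoning

      -- q is injective on {0, …, m - 1}: a repetition q i = q j would,
      -- after shifting by 1 - i, give s = pow (suc o) with o < m'.
      q-injective : ∀ i j → i < j → j < m → q i ≢ q j
      q-injective i j i<j j<m qi≡qj with m≤n⇒∃[o]m+o≡n i<j
      ... | o , refl = minimal o o<m' (sym s≡pow)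
        where
        open ≡-Reasoning
        to-one : ∀ i m' → 1 + i * suc m' ≡ i + suc (i * m')
        to-one = solve-∀
        to-o : ∀ i o m' → suc i + o + suc (i * m') ≡ suc (suc o) + i * suc m'
        to-o = solve-∀
        o<m' : o < m'
        o<m' = ≤-trans (s≤s (m≤n+m o i)) (≤-pred j<m)
        s≡pow : s ≡ pow (suc o)
        s≡pow = begin
          s                              ≡⟨ sym q-one ⟩
          q 1                            ≡⟨ sym (q-periodic 1 i) ⟩
          q (1 + i * m)                  ≡⟨ cong q (to-one i m') ⟩
          q (i + suc (i * m'))           ≡⟨ q-shift i (suc i + o) (suc (i * m')) qi≡qj ⟩
          q (suc i + o + suc (i * m'))   ≡⟨ cong q (to-o i o m') ⟩
          q (suc (suc o) + i * m)        ≡⟨ q-periodic (suc (suc o)) i ⟩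
          q (suc (suc o))                ≡⟨ sym (pow≡q (suc o)) ⟩
          pow (suc o)                    ∎

      e : Fin n
      e = q 0

      e-idempotent : e ∙ e ≡ e
      e-idempotent = sym (q-add 0 0)

      q-multiple-of-m : ∀ t → q (t * m) ≡ e
      q-multiple-of-m = q-periodic 0

      -- s⁺ is a subgroup with identity e; the inverse of q j is q (j * m').
      subgroup : ∀ {A} → A ≐⁺ ⁅ s ⁆ → IsSubgroup _∙_ A
      subgroup {A} A≐ = ≐⁺-subsemigroup A≐ , e , Equivalence.from (A≐ e) (q∈ 0) , identity , inverse
        where
        identity : ∀ g → g ∈ A → (e ∙ g ≡ g) × (g ∙ e ≡ g)
        identity g g∈ with q-onto (Equivalence.to (A≐ g) g∈)
        ... | j , _ , refl = sym (q-add 0 j) , trans (sym (q-add j 0)) (cong q (+-identityʳ j))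
        inverse : ∀ g → g ∈ A → ∃ λ h → h ∈ A × (g ∙ h ≡ e) × (h ∙ g ≡ e)
        inverse g g∈ with q-onto (Equivalence.to (A≐ g) g∈)
        ... | j , _ , refl =
          q (j * m') , Equivalence.from (A≐ _) (q∈ (j * m')) ,
          trans (sym (q-add j (j * m'))) (trans (cong q (sym (*-suc j m'))) (q-multiple-of-m j)) ,
          trans (sym (q-add (j * m') j))
                (trans (cong q (trans (+-comm (j * m') j) (sym (*-suc j m')))) (q-multiple-of-m j))

      order : ∀ {A} → A ≐⁺ ⁅ s ⁆ → ∣ A ∣ ≡ m
      order {A} A≐ = trans (cong ∣_∣ (⊆-antisym A⊆image image⊆A)) (∣image∣ q m q-injective)
        where
        A⊆image : ∀ {x} → x ∈ A → x ∈ image q m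
        A⊆image {x} x∈ with q-onto (Equivalence.to (A≐ x) x∈)
        ... | j , j<m , refl = image⁺ q m j<m
        image⊆A : ∀ {x} → x ∈ image q m → x ∈ A
        image⊆A {x} x∈ with image⁻ q m x∈
        ... | j , _ , refl = Equivalence.from (A≐ _) (q∈ j)

      order-one : m' ≡ 0 → ∀ {x} → ⟨ ⁅ s ⁆ ⟩ x → x ≡ s
      order-one refl x∈ with q-onto x∈
      ... | zero  , _       , refl = refl
      ... | suc _ , s≤s () , _

      q-multiples : ∀ {C} → IsSubsemigroup _∙_ C → ∀ j → q j ∈ C → ∀ t → q (suc t * j) ∈ C
      q-multiples {C} C-closed j qj∈ zero    = subst (_∈ C) (cong q (sym (+-identityʳ j))) qj∈
      q-multiples {C} C-closed j qj∈ (suc t) =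
        subst (_∈ C) (sym (q-add j (suc t * j))) (C-closed _ _ qj∈ (q-multiples C-closed j qj∈ t))

      prime⇒generates : Prime m → ∀ {C} → IsSubsemigroup _∙_ C → ∀ j → 0 < j → j < m → q j ∈ C → s ∈ C
      prime⇒generates m-prime {C} C-closed j@(suc _) 0<j j<m qj∈
        with multiple≡1 (prime⇒coprime m-prime j<m) 0<j
      ... | t , c , t*j≡1+c*m =
        subst (_∈ C) (trans (cong q t*j≡1+c*m) (trans (q-periodic 1 c) q-one)) (q-multiples C-closed j qj∈ t)

      -- A cyclic group of prime order is sji: {e} is its greatest proper
      -- subsemigroup, since a subsemigroup containing q j ≠ e contains s.
      prime⇒sji : ∀ {A} → A ≐⁺ ⁅ s ⁆ → Prime m → 1 < m → IsSji _∙_ A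
      prime⇒sji {A} A≐ m-prime 1<m =
        greatest-proper⇒sji (≐⁺-subsemigroup A≐) e-closed
          (⁅⁆-⊆ e∈A , s , ≐⁺-base A≐ s (x∈⁅x⁆ s) , s∉⁅e⁆) greatest
        where
        e∈A : e ∈ A
        e∈A = Equivalence.from (A≐ e) (q∈ 0)
        e-closed : IsSubsemigroup _∙_ ⁅ e ⁆
        e-closed a b a∈ b∈
          rewrite x∈⁅y⁆⇒x≡y e a∈ | x∈⁅y⁆⇒x≡y e b∈ = subst (_∈ ⁅ e ⁆) (sym e-idempotent) (x∈⁅x⁆ e)
        s∉⁅e⁆ : s ∉ ⁅ e ⁆
        s∉⁅e⁆ s∈ = q-injective 0 1 (s≤s z≤n) 1<m (trans (sym (x∈⁅y⁆⇒x≡y e s∈)) (sym q-one))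
        greatest : ∀ C → IsSubsemigroup _∙_ C → ⟦ C ⟧ ⊂ₚ ⟦ A ⟧ → ⟦ C ⟧ ⊆ₚ ⟦ ⁅ e ⁆ ⟧
        greatest C C-closed C⊂A x x∈C with q-onto (Equivalence.to (A≐ x) (proj₁ C⊂A x x∈C))
        ... | zero    , _   , refl = x∈⁅x⁆ e
        ... | suc j , j<m , refl =
          ⊥-elim (generator∉proper A≐ C-closed C⊂A
                   (prime⇒generates m-prime C-closed (suc j) (s≤s z≤n) j<m x∈C))

    -- Under the prime-order hypothesis s⁺ is sji in Sub(S): either s⁺ ∖ {s}
    -- is its greatest proper subsemigroup (s not periodic, or s⁺ = {s}),
    -- or s⁺ is a group of prime order.
    s⁺-sji : NontrivialSubgroupsPrime _∙_ → ∀ {A} → A ≐⁺ ⁅ s ⁆ → IsSji _∙_ A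
    s⁺-sji nsp {A} A≐ with periodic? A≐
    ... | no nonperiodic = removable-generator⇒sji A≐ (nonperiodic⇒removable A≐ nonperiodic)
    ... | yes periodic with minimal-period periodic
    ...   | zero , period , minimal =
      removable-generator⇒sji A≐
        (singleton-removable λ x x∈ → Group.order-one 0 period minimal refl (Equivalence.to (A≐ x) x∈))
    ...   | m'@(suc _) , period , minimal = prime⇒sji A≐ m-prime (s≤s (s≤s z≤n))
      where
      open Group m' period minimal
      m-prime : Prime m
      m-prime = subst Prime (order A≐) (nsp A (subgroup A≐) (subst (1 <_) (sym (order A≐)) (s≤s (s≤s z≤n))))

    -- In an aperiodic semigroup a periodic element s generates just {s}:
    -- the group s⁺ must be trivial.
    aperiodic-periodic : Aperiodic _∙_ → Periodic → ∀ {x} → ⟨ ⁅ s ⁆ ⟩ x → x ≡ s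
    aperiodic-periodic aperiodic periodic with minimal-period periodic | closure ⁅ s ⁆
    ... | m' , period , minimal | A , A≐ = order-one (suc-injective (trans (sym (order A≐)) (aperiodic A (subgroup A≐))))
      where open Group m' period minimal

  cyclic⇒sji : NontrivialSubgroupsPrime _∙_ → ∀ A → IsCyclic _∙_ A → IsSji _∙_ A
  cyclic⇒sji nsp A (s , A≐) = Powers.s⁺-sji s nsp A≐

  -- In an aperiodic semigroup distinct elements generate distinct cyclic
  -- subsemigroups: s⁺ = t⁺ with s ≠ t gives t = s ∙ u and s = t ∙ v, so s is
  -- periodic, s⁺ = {s}, and t = s.
  aperiodic⇒distinct : Aperiodic _∙_ → ∀ s t → s ≢ t → ¬ (∀ x → Cyc _∙_ s x ⇔ Cyc _∙_ t x)
  aperiodic⇒distinct aperiodic s t s≢t same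
    with Powers.∈⇒s∙ s (Equivalence.from (same t) (gen (x∈⁅x⁆ t))) (λ t≡s → s≢t (sym t≡s))
       | Powers.∈⇒s∙ t (Equivalence.to (same s) (gen (x∈⁅x⁆ s))) s≢t
  ... | u , u∈ , refl | v , v∈ , s≡tv =
    s≢t (sym (Powers.aperiodic-periodic s aperiodic
                (u ∙ v , mul u∈ (Equivalence.from (same v) v∈) , trans (sym (assoc s u v)) (sym s≡tv))
                (Equivalence.from (same (s ∙ u)) (gen (x∈⁅x⁆ (s ∙ u))))))

  H₀≅HSub : NontrivialSubgroupsPrime _∙_ → IsIso (H0 _∙_) (HSub _∙_) (λ A → A)
  H₀≅HSub nsp = record
    { maps-to    = cyclic⇒sji nsp
    ; injective  = λ _ _ _ _ A≡B → A≡B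
    ; surjective = λ A A-sji → A , sji⇒cyclic A A-sji , refl
    ; faces      = faces
    }
    where
    faces : ∀ X → All (IsCyclic _∙_) X → Unique X → Face (H0 _∙_) X ⇔ Face (HSub _∙_) (map (λ A → A) X)
    faces X _ _ rewrite map-id X = mk⇔
      (λ { (L , L↭X , chain) → L , L↭X , Equivalence.to (strict⇔lattice L) chain })
      (λ { (L , L↭X , chain) → L , L↭X , Equivalence.from (strict⇔lattice L) chain })

  -- For aperiodic S, s ↦ s⁺ identifies H(S) with H₀(S): it is injective by
  -- aperiodicity, and {s} generates the same subsemigroup as s⁺, so the
  -- strict chains correspond.
  HS≅H₀ : Aperiodic _∙_ → (c : Fin n → Subset n) → (∀ s x → x ∈ c s ⇔ Cyc _∙_ s x) →
          IsIso (HS _∙_) (H0 _∙_) c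
  HS≅H₀ aperiodic c c≐ = record
    { maps-to    = λ s _ → s , c≐ s
    ; injective  = injective
    ; surjective = surjective
    ; faces      = λ X _ _ → mk⇔ (forward X) (backward X)
    }
    where
    injective : ∀ s t → ⊤ → ⊤ → c s ≡ c t → s ≡ t
    injective s t _ _ cs≡ct with s ≟ᶠ t
    ... | yes s≡t = s≡t
    ... | no  s≢t = ⊥-elim (aperiodic⇒distinct aperiodic s t s≢t λ x → mk⇔
      (λ x∈ → Equivalence.to (c≐ t x) (subst (x ∈_) cs≡ct (Equivalence.from (c≐ s x) x∈)))
      (λ x∈ → Equivalence.to (c≐ s x) (subst (x ∈_) (sym cs≡ct) (Equivalence.from (c≐ t x) x∈))))
    surjective : ∀ A → IsCyclic _∙_ A → ∃ λ s → ⊤ × c s ≡ A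
    surjective A (s , A≐) = s , tt , ⊆-antisym
      (λ {x} x∈ → Equivalence.from (A≐ x) (Equivalence.to (c≐ s x) x∈))
      (λ {x} x∈ → Equivalence.from (c≐ s x) (Equivalence.to (A≐ x) x∈))
    ⁅s⁆≈c : ∀ {s} → ⁅ s ⁆ ≈⁺ c s
    ⁅s⁆≈c {s} = ≐⁺⇒≈⁺ (c≐ s)
    forward : ∀ X → Face (HS _∙_) X → Face (H0 _∙_) (map c X)
    forward X (L , L↭X , chain) =
      map c L , Perm.map⁺ c L↭X ,
      chain-resp-≈⁺ ≈⁺-refl (Pointwise.map⁺ ⁅_⁆ c (Pointwise.refl ⁅s⁆≈c)) chain
    backward : ∀ X → Face (H0 _∙_) (map c X) → Face (HS _∙_) X
    backward X (L' , L'↭cX , chain) with ↭-map-inv c (↭-sym L'↭cX)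
    ... | L , refl , X↭L =
      L , ↭-sym X↭L ,
      chain-resp-≈⁺ ≈⁺-refl (Pointwise.map⁺ c ⁅_⁆ (Pointwise.refl (≈⁺-sym ⁅s⁆≈c))) chain

proposition4p2 : (n : ℕ) → 0 < n → (_∙_ : Op₂ (Fin n)) → IsSemigroup _≡_ _∙_ →
    NontrivialSubgroupsPrime _∙_ →
    Isomorphic (H0 _∙_) (HSub _∙_) ×
    (Aperiodic _∙_ →
      (∀ s t → ¬ s ≡ t → ¬ (∀ x → Cyc _∙_ s x ⇔ Cyc _∙_ t x)) ×
      (∀ (c : Fin n → Subset n) → (∀ s x → x ∈ c s ⇔ Cyc _∙_ s x) →
        IsIso (HS _∙_) (H0 _∙_) c))
proposition4p2 n _ _∙_ isSemigroup nsp =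
  ((λ A → A) , H₀≅HSub nsp) , λ aperiodic → aperiodic⇒distinct aperiodic , HS≅H₀ aperiodic
  where open Cyclic _∙_ (IsSemigroup.assoc isSemigroup)
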